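{- Let $G$ be an $n$-vertex graph with a fixed ordering of $V(G)$, $(T,\delta)$ a rooted layout of $G$, and let $a$ and $b$ be the children of an internal node $x$ of $T$. Let $A\in\mathrm{Rep}^n_{V_a}$ and $B\in\mathrm{Rep}^n_{V_b}$. For every $X\subseteq V_a$ and $W\subseteq V_b$ such that $A\equiv^n_{V_a}X$ and $B\equiv^n_{V_b}W$, the number of edges between $X\cup W$ and $V_x\setminus(X\cup W)$ equals \[|E(X,V_a\setminus X)|+|E(W,V_b\setminus W)|+|E(A,V_b\setminus B)|+|E(B,V_a\setminus A)|.\]
   Context: A rooted layout of $G$ is a pair $(T,\delta)$ with $T$ a rooted binary tree and $\delta$ a bijection between $V(G)$ and the leaves of $T$; for a node $y$, $V_y$ is the set of vertices $v$ such that the root-to-$\delta(v)$ path contains $y$ (so $V_x$ is the disjoint union of $V_a$ and $V_b$). For $S\subseteq V(G)$, $X\equiv^n_S Y$ (for $X,Y\subseteq S$) means $\min(n,|X\cap N(u)|)=\min(n,|Y\cap N(u)|)$ for all $u\in V(G)\setminus S$. $\mathsf{rep}^n_S(X)$ is the lexicographically smallest among minimum-size $R\subseteq S$ with $R\equiv^n_S X$, and $\mathrm{Rep}^n_S=\{\mathsf{rep}^n_S(X):X\subseteq S\}$. $E(X,Y)$ is the set of edges with one endpoint in $X$ and the other in $Y$. -}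

module Defs where

open import Data.Nat using (ℕ; _+_; _⊓_; _≤_; _<_; _<ᵇ_)
open import Data.Bool using (Bool; true; false; _∧_; _∨_; if_then_else_)
open import Data.Fin using (Fin; toℕ)
open import Data.Fin.Subset using (Subset; ⁅_⁆; _∪_; _∩_; _─_; _⊆_; _∉_; ∣_∣)
open import Data.Vec using (lookup; tabulate)
open import Data.List using (List; []; _∷_; allFin; filterᵇ; map)
open import Data.Nat.ListAction using (sum)
open import Data.Product using (Σ; _×_)
open import Relation.Binary.PropositionalEquality using (_≡_)

-- A finite simple graph on vertex set Fin n (the fixed ordering of V(G)
-- is the natural order of Fin n).
record Graph (n : ℕ) : Set where
  field
    adj   : Fin n → Fin n → Bool
    sym   : ∀ u v → adj u v ≡ adj v u
    irrefl : ∀ v → adj v v ≡ false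
open Graph public

N : ∀ {n} → Graph n → Fin n → Subset n
N G u = tabulate (adj G u)

edgeCount : ∀ {n} → Graph n → Subset n → Subset n → ℕ
edgeCount {n} G X Y =
  sum (map (λ u → sum (map (λ v →
      if (toℕ u <ᵇ toℕ v) ∧ adj G u v ∧
         ((lookup X u ∧ lookup Y v) ∨ (lookup X v ∧ lookup Y u))
      then 1 else 0) (allFin n))) (allFin n))

Equiv : ∀ {n} → Graph n → Subset n → Subset n → Subset n → Set
Equiv {n} G S X Y = ∀ u → u ∉ S → n ⊓ ∣ X ∩ N G u ∣ ≡ n ⊓ ∣ Y ∩ N G u ∣

elems : ∀ {n} → Subset n → List (Fin n)
elems {n} S = filterᵇ (lookup S) (allFin n)

data LexLeq {n : ℕ} : List (Fin n) → List (Fin n) → Set where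
  lex-[] : ∀ {ys} → LexLeq [] ys
  lex-<  : ∀ {x y xs ys} → toℕ x < toℕ y → LexLeq (x ∷ xs) (y ∷ ys)
  lex-≡  : ∀ {x xs ys} → LexLeq xs ys → LexLeq (x ∷ xs) (x ∷ ys)

IsRep : ∀ {n} → Graph n → Subset n → Subset n → Subset n → Set
IsRep G S X R =
  R ⊆ S × Equiv G S R X ×
  (∀ R' → R' ⊆ S → Equiv G S R' X → ∣ R ∣ ≤ ∣ R' ∣) ×
  (∀ R' → R' ⊆ S → Equiv G S R' X → ∣ R' ∣ ≡ ∣ R ∣ → LexLeq (elems R) (elems R'))

InRep : ∀ {n} → Graph n → Subset n → Subset n → Set
InRep {n} G S R = Σ (Subset n) λ X → X ⊆ S × IsRep G S X R

data Tree (n : ℕ) : Set where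
  leaf : Fin n → Tree n
  node : Tree n → Tree n → Tree n

leaves : ∀ {n} → Tree n → List (Fin n)
leaves (leaf v)   = v ∷ []
leaves (node l r) = leaves l Data.List.++ leaves r

open import Data.List.Relation.Unary.Unique.Propositional using (Unique)
open import Data.List.Membership.Propositional using () renaming (_∈_ to _∈ₗ_)

IsLayout : ∀ {n} → Tree n → Set
IsLayout {n} T = Unique (leaves T) × (∀ (v : Fin n) → v ∈ₗ leaves T)

-- Nodes of T, identified with the subtrees rooted at them.
data _≼_ {n : ℕ} (t : Tree n) : Tree n → Set where
  here  : t ≼ t
  left  : ∀ {l r} → t ≼ l → t ≼ node l r
  right : ∀ {l r} → t ≼ r → t ≼ node l r

V : ∀ {n} → Tree n → Subset n
V (leaf v)   = ⁅ v ⁆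
V (node l r) = V l ∪ V r

module Submission where

-- Count edges with the bilinear form
--   arcs G P Q = #{(u,v) : u ∈ P, v ∈ Q, uv ∈ E(G)},
-- which agrees with edgeCount G P Q whenever P and Q are disjoint.  Three
-- facts about arcs drive the argument:
--   * it is symmetric and additive in each argument over disjoint unions;
--   * arcs G P Q = Σ_{v ∈ Q} |P ∩ N(v)|, so P may be replaced by any P'
--     with the same neighbourhood counts on Q;
--   * the n-truncation in ≡^n_S is vacuous (|P ∩ N(u)| ≤ n), so X ≡^n_S Y
--     says exactly that X and Y have the same neighbourhood counts off S.
-- For the theorem, V_x ∖ (X ∪ W) is the disjoint union of V_a ∖ X and
-- V_b ∖ W (V_a and V_b are disjoint because the leaves of a layout are
-- distinct), so bilinearity splits the left-hand side into four terms.
-- The two terms inside V_a and V_b are already in final form; each cross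
-- term arcs X (V_b ∖ W) becomes arcs A (V_b ∖ B) by exchanging X for A
-- (they agree off V_a) and then W for B inside the complement (they agree
-- off V_b).

open import Defs
open import Data.Nat using (ℕ; _+_)
open import Data.Fin.Subset using (Subset; _∪_; _─_; _⊆_)
open import Relation.Binary.PropositionalEquality using (_≡_)

open import Data.Nat using (zero; suc; _*_; _⊓_; _<ᵇ_)
open import Data.Nat.Properties
  using (+-*-semiring; +-commutativeSemigroup; *-commutativeSemigroup; +-assoc; +-identityʳ; *-comm; *-zeroʳ;
         *-distribˡ-+; *-distribʳ-+; +-cancelʳ-≡; m≥n⇒m⊓n≡n)
open import Data.Nat.Tactic.RingSolver using (solve-∀)
open import Data.Nat.ListAction using () renaming (sum to listSum)
open import Data.Bool using (Bool; true; false; _∧_; _∨_; if_then_else_)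
open import Data.Bool.Properties using (∧-zeroʳ)
open import Data.Fin using (Fin; toℕ; _≟_) renaming (zero to fzero; suc to fsuc)
open import Data.Fin.Properties using (toℕ-injective)
open import Data.Fin.Subset using (_∩_; ∣_∣; _∈_; _∉_)
open import Data.Fin.Subset.Properties
  using (_∈?_; ∣p∣≤n; x∈p∪q⁻; p⊆p∪q; q⊆p∪q; x∈p∧x∉q⇒x∈p─q; p─q⊆p; ⊆-refl; x∈⁅y⁆⇒x≡y)
open import Data.Vec using (lookup; _∷_; []; here; there)
open import Data.Vec.Properties using (lookup-zipWith; lookup∘tabulate; []=⇒lookup; lookup⇒[]=)
open import Data.List using (List; _∷_; []; map; allFin; _++_) renaming (tabulate to listTabulate)
open import Data.List.Properties using (map-tabulate)
open import Data.List.Relation.Unary.All using () renaming (lookup to allLookup)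
open import Data.List.Relation.Unary.All.Properties using (++⁻ˡ; ++⁻ʳ)
open import Data.List.Relation.Unary.AllPairs using ([]; _∷_)
open import Data.List.Relation.Unary.Unique.Propositional using (Unique)
open import Data.List.Membership.Propositional using () renaming (_∈_ to _∈ₗ_; _∉_ to _∉ₗ_)
open import Data.List.Membership.Propositional.Properties using (∈-++⁺ˡ; ∈-++⁺ʳ)
open import Data.List.Relation.Unary.Any using (here; there)
open import Data.Product using (_,_)
open import Data.Sum using ([_,_]′)
open import Function using (_∘_)
open import Relation.Nullary using (yes; no; contradiction)
open import Relation.Binary.PropositionalEquality
  using (_≢_; refl; trans; cong; cong₂; module ≡-Reasoning) renaming (sym to ≡-sym)
open import Algebra.Properties.CommutativeSemigroup +-commutativeSemigroup using (interchange)
open import Algebra.Properties.CommutativeSemigroup *-commutativeSemigroup using (xy∙z≈y∙xz; x∙yz≈y∙xz)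
open import Algebra.Properties.Semiring.Sum +-*-semiring
  using (sum-syntax; sum-cong-≗; ∑-distrib-+; ∑-comm; *-distribˡ-sum)

open ≡-Reasoning

private
  variable
    n : ℕ
    P P₁ P₂ Q Q' Q₁ Q₂ S S' Z : Subset n
    v : Fin n

listSum-allFin : (f : Fin n → ℕ) → listSum (map f (allFin n)) ≡ ∑[ i < n ] f i
listSum-allFin f = trans (cong listSum (map-tabulate (λ i → i) f)) (tabulated f)
  where
  tabulated : ∀ {m} (g : Fin m → ℕ) → listSum (listTabulate g) ≡ ∑[ i < m ] g i
  tabulated {zero}  g = refl
  tabulated {suc m} g = cong (g fzero +_) (tabulated (g ∘ fsuc))

∑∑-cong : {f g : Fin n → Fin n → ℕ} → (∀ u v → f u v ≡ g u v) →
          ∑[ u < n ] ∑[ v < n ] f u v ≡ ∑[ u < n ] ∑[ v < n ] g u v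
∑∑-cong f≡g = sum-cong-≗ (λ u → sum-cong-≗ (f≡g u))

∑∑-distrib-+ : (f g : Fin n → Fin n → ℕ) →
  ∑[ u < n ] ∑[ v < n ] (f u v + g u v)
    ≡ ∑[ u < n ] ∑[ v < n ] f u v + ∑[ u < n ] ∑[ v < n ] g u v
∑∑-distrib-+ {n} f g = trans (sum-cong-≗ (λ u → ∑-distrib-+ (f u) (g u)))
  (∑-distrib-+ (λ u → ∑[ v < n ] f u v) (λ u → ∑[ v < n ] g u v))

𝟙 : Bool → ℕ
𝟙 b = if b then 1 else 0

𝟙[_] : Subset n → Fin n → ℕ
𝟙[ P ] v = 𝟙 (lookup P v)

edge : Graph n → Fin n → Fin n → ℕ
edge G u v = 𝟙 (adj G u v)

edge-sym : (G : Graph n) (u v : Fin n) → edge G u v ≡ edge G v u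
edge-sym G u v = cong 𝟙 (sym G u v)

𝟙-∧ : ∀ a b → 𝟙 (a ∧ b) ≡ 𝟙 a * 𝟙 b
𝟙-∧ true  b = ≡-sym (+-identityʳ (𝟙 b))
𝟙-∧ false b = refl

𝟙-∨ : ∀ a b → a ∧ b ≡ false → 𝟙 (a ∨ b) ≡ 𝟙 a + 𝟙 b
𝟙-∨ true  true  ()
𝟙-∨ true  false _ = refl
𝟙-∨ false b     _ = refl

𝟙-∈ : v ∈ P → 𝟙[ P ] v ≡ 1
𝟙-∈ v∈P = cong 𝟙 ([]=⇒lookup v∈P)

∉⇒lookup : v ∉ P → lookup P v ≡ false
∉⇒lookup {v = v} {P = P} v∉P with lookup P v in v∈P
... | false = refl
... | true  = contradiction (lookup⇒[]= v P v∈P) v∉P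

𝟙-∉ : v ∉ P → 𝟙[ P ] v ≡ 0
𝟙-∉ v∉P = cong 𝟙 (∉⇒lookup v∉P)

∣_∣≡∑ : (P : Subset n) → ∣ P ∣ ≡ ∑[ v < n ] 𝟙[ P ] v
∣ []        ∣≡∑ = refl
∣ true  ∷ P ∣≡∑ = cong suc ∣ P ∣≡∑
∣ false ∷ P ∣≡∑ = ∣ P ∣≡∑

deg : Graph n → Subset n → Fin n → ℕ
deg G P v = ∣ P ∩ N G v ∣

deg≡∑ : (G : Graph n) (P : Subset n) (v : Fin n) →
        deg G P v ≡ ∑[ u < n ] (𝟙[ P ] u * edge G u v)
deg≡∑ G P v = trans ∣ P ∩ N G v ∣≡∑ (sum-cong-≗ member)
  where
  member : ∀ u → 𝟙[ P ∩ N G v ] u ≡ 𝟙[ P ] u * edge G u v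
  member u = begin
    𝟙 (lookup (P ∩ N G v) u)            ≡⟨ cong 𝟙 (lookup-zipWith _∧_ u P (N G v)) ⟩
    𝟙 (lookup P u ∧ lookup (N G v) u)   ≡⟨ 𝟙-∧ (lookup P u) _ ⟩
    𝟙[ P ] u * 𝟙 (lookup (N G v) u)     ≡⟨ cong (λ b → 𝟙[ P ] u * 𝟙 b) (lookup∘tabulate (adj G v) u) ⟩
    𝟙[ P ] u * edge G v u               ≡⟨ cong (𝟙[ P ] u *_) (edge-sym G v u) ⟩
    𝟙[ P ] u * edge G u v               ∎

-- Every vertex has at most n neighbours, so the truncation at n in X ≡^n_S Y
-- is vacuous: equivalent sets have equal neighbourhood counts outside S.
Equiv⇒deg : (G : Graph n) (R X : Subset n) → Equiv G S R X →
            ∀ {u} → u ∉ S → deg G R u ≡ deg G X u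
Equiv⇒deg {n} G R X R≡X {u} u∉S = begin
  deg G R u           ≡⟨ m≥n⇒m⊓n≡n (∣p∣≤n (R ∩ N G u)) ⟨
  n ⊓ deg G R u       ≡⟨ R≡X u u∉S ⟩
  n ⊓ deg G X u       ≡⟨ m≥n⇒m⊓n≡n (∣p∣≤n (X ∩ N G u)) ⟩
  deg G X u           ∎

Disjoint : Subset n → Subset n → Set
Disjoint P Q = ∀ {v} → v ∈ P → v ∉ Q

Disjoint-sym : Disjoint P Q → Disjoint Q P
Disjoint-sym P#Q v∈Q v∈P = P#Q v∈P v∈Q

Disjoint-⊆ : P ⊆ S → Q ⊆ S' → Disjoint S S' → Disjoint P Q
Disjoint-⊆ P⊆S Q⊆S' S#S' v∈P v∈Q = S#S' (P⊆S v∈P) (Q⊆S' v∈Q)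

Disjoint-─ : (Z S : Subset n) → Disjoint Z (S ─ Z)
Disjoint-─ (true ∷ Z) (s ∷ S) here ()
Disjoint-─ (_    ∷ Z) (_ ∷ S) (there v∈Z) (there v∈S─Z) = Disjoint-─ Z S v∈Z v∈S─Z

-- Q ≐ Q₁ ⊕ Q₂ : Q is the disjoint union of Q₁ and Q₂ (read on indicators).
-- A record, so that the three sets can be inferred from a proof.
record _≐_⊕_ (Q Q₁ Q₂ : Subset n) : Set where
  constructor pointwise
  field at : ∀ v → 𝟙[ Q ] v ≡ 𝟙[ Q₁ ] v + 𝟙[ Q₂ ] v
open _≐_⊕_

∪-⊕ : Disjoint P Q → (P ∪ Q) ≐ P ⊕ Q
∪-⊕ {P = P} {Q = Q} P#Q = pointwise split
  where
  split : ∀ v → 𝟙[ P ∪ Q ] v ≡ 𝟙[ P ] v + 𝟙[ Q ] v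
  split v with v ∈? P | v ∈? Q
  ... | yes v∈P | _       = begin
    𝟙[ P ∪ Q ] v       ≡⟨ 𝟙-∈ (p⊆p∪q Q v∈P) ⟩
    1                  ≡⟨ cong₂ _+_ (𝟙-∈ v∈P) (𝟙-∉ (P#Q v∈P)) ⟨
    𝟙[ P ] v + 𝟙[ Q ] v ∎
  ... | no v∉P  | yes v∈Q = begin
    𝟙[ P ∪ Q ] v       ≡⟨ 𝟙-∈ (q⊆p∪q P Q v∈Q) ⟩
    1                  ≡⟨ cong₂ _+_ (𝟙-∉ v∉P) (𝟙-∈ v∈Q) ⟨
    𝟙[ P ] v + 𝟙[ Q ] v ∎
  ... | no v∉P  | no v∉Q  = begin
    𝟙[ P ∪ Q ] v       ≡⟨ 𝟙-∉ (λ v∈P∪Q → [ v∉P , v∉Q ]′ (x∈p∪q⁻ P Q v∈P∪Q)) ⟩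
    0                  ≡⟨ cong₂ _+_ (𝟙-∉ v∉P) (𝟙-∉ v∉Q) ⟨
    𝟙[ P ] v + 𝟙[ Q ] v ∎

─-⊕ : Z ⊆ S → S ≐ (S ─ Z) ⊕ Z
─-⊕ {Z = Z} {S = S} Z⊆S = pointwise split
  where
  split : ∀ v → 𝟙[ S ] v ≡ 𝟙[ S ─ Z ] v + 𝟙[ Z ] v
  split v with v ∈? Z | v ∈? S
  ... | yes v∈Z | _       = begin
    𝟙[ S ] v                 ≡⟨ 𝟙-∈ (Z⊆S v∈Z) ⟩
    1                        ≡⟨ cong₂ _+_ (𝟙-∉ (Disjoint-─ Z S v∈Z)) (𝟙-∈ v∈Z) ⟨
    𝟙[ S ─ Z ] v + 𝟙[ Z ] v  ∎
  ... | no v∉Z  | yes v∈S = begin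
    𝟙[ S ] v                 ≡⟨ 𝟙-∈ v∈S ⟩
    1                        ≡⟨ cong₂ _+_ (𝟙-∈ (x∈p∧x∉q⇒x∈p─q v∈S v∉Z)) (𝟙-∉ v∉Z) ⟨
    𝟙[ S ─ Z ] v + 𝟙[ Z ] v  ∎
  ... | no v∉Z  | no v∉S  = begin
    𝟙[ S ] v                 ≡⟨ 𝟙-∉ v∉S ⟩
    0                        ≡⟨ cong₂ _+_ (𝟙-∉ (v∉S ∘ p─q⊆p S Z)) (𝟙-∉ v∉Z) ⟨
    𝟙[ S ─ Z ] v + 𝟙[ Z ] v  ∎

∪─∪-⊕ : {S₁ S₂ Z₁ Z₂ : Subset n} → Disjoint S₁ S₂ → Z₁ ⊆ S₁ → Z₂ ⊆ S₂ →
        ((S₁ ∪ S₂) ─ (Z₁ ∪ Z₂)) ≐ (S₁ ─ Z₁) ⊕ (S₂ ─ Z₂)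
∪─∪-⊕ {S₁ = S₁} {S₂} {Z₁} {Z₂} S₁#S₂ Z₁⊆S₁ Z₂⊆S₂ = pointwise split
  where
  Z₁#Z₂ : Disjoint Z₁ Z₂
  Z₁#Z₂ = Disjoint-⊆ Z₁⊆S₁ Z₂⊆S₂ S₁#S₂
  Z⊆S : (Z₁ ∪ Z₂) ⊆ (S₁ ∪ S₂)
  Z⊆S v∈Z = [ p⊆p∪q S₂ ∘ Z₁⊆S₁ , q⊆p∪q S₁ S₂ ∘ Z₂⊆S₂ ]′ (x∈p∪q⁻ Z₁ Z₂ v∈Z)
  -- Both sides, once the count of Z₁ ∪ Z₂ is added back, give S₁ ∪ S₂.
  split : ∀ v → 𝟙[ (S₁ ∪ S₂) ─ (Z₁ ∪ Z₂) ] v ≡ 𝟙[ S₁ ─ Z₁ ] v + 𝟙[ S₂ ─ Z₂ ] v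
  split v = +-cancelʳ-≡ (𝟙[ Z₁ ] v + 𝟙[ Z₂ ] v)
    (𝟙[ (S₁ ∪ S₂) ─ (Z₁ ∪ Z₂) ] v) (𝟙[ S₁ ─ Z₁ ] v + 𝟙[ S₂ ─ Z₂ ] v) (begin
    𝟙[ (S₁ ∪ S₂) ─ (Z₁ ∪ Z₂) ] v + (𝟙[ Z₁ ] v + 𝟙[ Z₂ ] v)
      ≡⟨ cong (𝟙[ (S₁ ∪ S₂) ─ (Z₁ ∪ Z₂) ] v +_) (at (∪-⊕ Z₁#Z₂) v) ⟨
    𝟙[ (S₁ ∪ S₂) ─ (Z₁ ∪ Z₂) ] v + 𝟙[ Z₁ ∪ Z₂ ] v
      ≡⟨ at (─-⊕ Z⊆S) v ⟨
    𝟙[ S₁ ∪ S₂ ] v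
      ≡⟨ at (∪-⊕ S₁#S₂) v ⟩
    𝟙[ S₁ ] v + 𝟙[ S₂ ] v
      ≡⟨ cong₂ _+_ (at (─-⊕ Z₁⊆S₁) v) (at (─-⊕ Z₂⊆S₂) v) ⟩
    (𝟙[ S₁ ─ Z₁ ] v + 𝟙[ Z₁ ] v) + (𝟙[ S₂ ─ Z₂ ] v + 𝟙[ Z₂ ] v)
      ≡⟨ interchange (𝟙[ S₁ ─ Z₁ ] v) (𝟙[ Z₁ ] v) (𝟙[ S₂ ─ Z₂ ] v) (𝟙[ Z₂ ] v) ⟩
    (𝟙[ S₁ ─ Z₁ ] v + 𝟙[ S₂ ─ Z₂ ] v) + (𝟙[ Z₁ ] v + 𝟙[ Z₂ ] v)
      ∎)

arc : Graph n → Subset n → Subset n → Fin n → Fin n → ℕ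
arc G P Q u v = 𝟙[ P ] u * 𝟙[ Q ] v * edge G u v

arcs : Graph n → Subset n → Subset n → ℕ
arcs {n} G P Q = ∑[ u < n ] ∑[ v < n ] arc G P Q u v

arcs-sym : (G : Graph n) (P Q : Subset n) → arcs G P Q ≡ arcs G Q P
arcs-sym G P Q = trans (∑-comm (arc G P Q)) (∑∑-cong swap)
  where
  swap : ∀ u v → 𝟙[ P ] v * 𝟙[ Q ] u * edge G v u ≡ 𝟙[ Q ] u * 𝟙[ P ] v * edge G u v
  swap u v = cong₂ _*_ (*-comm (𝟙[ P ] v) (𝟙[ Q ] u)) (edge-sym G v u)

arcs-⊕ʳ : (G : Graph n) (P : Subset n) → Q ≐ Q₁ ⊕ Q₂ →
          arcs G P Q ≡ arcs G P Q₁ + arcs G P Q₂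
arcs-⊕ʳ {Q = Q} {Q₁ = Q₁} {Q₂ = Q₂} G P Q≐Q₁⊕Q₂ =
  trans (∑∑-cong split) (∑∑-distrib-+ (arc G P Q₁) (arc G P Q₂))
  where
  split : ∀ u v → arc G P Q u v ≡ arc G P Q₁ u v + arc G P Q₂ u v
  split u v = begin
    𝟙[ P ] u * 𝟙[ Q ] v * edge G u v
      ≡⟨ cong (λ q → 𝟙[ P ] u * q * edge G u v) (at Q≐Q₁⊕Q₂ v) ⟩
    𝟙[ P ] u * (𝟙[ Q₁ ] v + 𝟙[ Q₂ ] v) * edge G u v
      ≡⟨ cong (_* edge G u v) (*-distribˡ-+ (𝟙[ P ] u) (𝟙[ Q₁ ] v) (𝟙[ Q₂ ] v)) ⟩
    (𝟙[ P ] u * 𝟙[ Q₁ ] v + 𝟙[ P ] u * 𝟙[ Q₂ ] v) * edge G u v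
      ≡⟨ *-distribʳ-+ (edge G u v) (𝟙[ P ] u * 𝟙[ Q₁ ] v) (𝟙[ P ] u * 𝟙[ Q₂ ] v) ⟩
    arc G P Q₁ u v + arc G P Q₂ u v
      ∎

arcs-⊕ˡ : (G : Graph n) (Q : Subset n) → P ≐ P₁ ⊕ P₂ →
          arcs G P Q ≡ arcs G P₁ Q + arcs G P₂ Q
arcs-⊕ˡ {P = P} {P₁} {P₂} G Q P≐P₁⊕P₂ = begin
  arcs G P Q                     ≡⟨ arcs-sym G P Q ⟩
  arcs G Q P                     ≡⟨ arcs-⊕ʳ G Q P≐P₁⊕P₂ ⟩
  arcs G Q P₁ + arcs G Q P₂      ≡⟨ cong₂ _+_ (arcs-sym G Q P₁) (arcs-sym G Q P₂) ⟩
  arcs G P₁ Q + arcs G P₂ Q      ∎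

arcs-bilinear : (G : Graph n) → P ≐ P₁ ⊕ P₂ → Q ≐ Q₁ ⊕ Q₂ →
  arcs G P Q ≡ arcs G P₁ Q₁ + arcs G P₁ Q₂ + arcs G P₂ Q₁ + arcs G P₂ Q₂
arcs-bilinear {P = P} {P₁ = P₁} {P₂ = P₂} {Q = Q} {Q₁ = Q₁} {Q₂ = Q₂} G P-split Q-split =
  begin
  arcs G P Q
    ≡⟨ arcs-⊕ˡ G Q P-split ⟩
  arcs G P₁ Q + arcs G P₂ Q
    ≡⟨ cong₂ _+_ (arcs-⊕ʳ G P₁ Q-split) (arcs-⊕ʳ G P₂ Q-split) ⟩
  (arcs G P₁ Q₁ + arcs G P₁ Q₂) + (arcs G P₂ Q₁ + arcs G P₂ Q₂)
    ≡⟨ +-assoc (arcs G P₁ Q₁ + arcs G P₁ Q₂) _ _ ⟨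
  arcs G P₁ Q₁ + arcs G P₁ Q₂ + arcs G P₂ Q₁ + arcs G P₂ Q₂
    ∎

arcs-by-heads : (G : Graph n) (P Q : Subset n) →
                arcs G P Q ≡ ∑[ v < n ] (𝟙[ Q ] v * deg G P v)
arcs-by-heads {n} G P Q = begin
  ∑[ u < n ] ∑[ v < n ] (𝟙[ P ] u * 𝟙[ Q ] v * edge G u v)
    ≡⟨ ∑-comm (arc G P Q) ⟩
  ∑[ v < n ] ∑[ u < n ] (𝟙[ P ] u * 𝟙[ Q ] v * edge G u v)
    ≡⟨ ∑∑-cong (λ v u → xy∙z≈y∙xz (𝟙[ P ] u) (𝟙[ Q ] v) (edge G u v)) ⟩
  ∑[ v < n ] ∑[ u < n ] (𝟙[ Q ] v * (𝟙[ P ] u * edge G u v))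
    ≡⟨ sum-cong-≗ (λ v → *-distribˡ-sum (𝟙[ Q ] v) (λ u → 𝟙[ P ] u * edge G u v)) ⟨
  ∑[ v < n ] (𝟙[ Q ] v * ∑[ u < n ] (𝟙[ P ] u * edge G u v))
    ≡⟨ sum-cong-≗ (λ v → cong (𝟙[ Q ] v *_) (deg≡∑ G P v)) ⟨
  ∑[ v < n ] (𝟙[ Q ] v * deg G P v)
    ∎

arcs-transferˡ : (G : Graph n) (P P' Q : Subset n) →
  (∀ {v} → v ∈ Q → deg G P v ≡ deg G P' v) → arcs G P Q ≡ arcs G P' Q
arcs-transferˡ G P P' Q same-deg = begin
  arcs G P Q                              ≡⟨ arcs-by-heads G P Q ⟩
  ∑[ v < _ ] (𝟙[ Q ] v * deg G P v)       ≡⟨ sum-cong-≗ term ⟩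
  ∑[ v < _ ] (𝟙[ Q ] v * deg G P' v)      ≡⟨ arcs-by-heads G P' Q ⟨
  arcs G P' Q                             ∎
  where
  term : ∀ v → 𝟙[ Q ] v * deg G P v ≡ 𝟙[ Q ] v * deg G P' v
  term v with v ∈? Q
  ... | yes v∈Q = cong (𝟙[ Q ] v *_) (same-deg v∈Q)
  ... | no  v∉Q = trans (cong (_* deg G P v) (𝟙-∉ v∉Q)) (≡-sym (cong (_* deg G P' v) (𝟙-∉ v∉Q)))

-- Exchanging Q for Q' inside S: if Q, Q' ⊆ S have the same neighbourhood
-- counts off S, then from any P outside S, S ∖ Q and S ∖ Q' receive
-- equally many arcs (both complete P's arcs into S).
arcs-complement : (G : Graph n) → Q ⊆ S → Q' ⊆ S →
  (∀ {u} → u ∉ S → deg G Q u ≡ deg G Q' u) → Disjoint P S →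
  arcs G P (S ─ Q) ≡ arcs G P (S ─ Q')
arcs-complement {Q = Q} {S = S} {Q' = Q'} {P = P} G Q⊆S Q'⊆S same-deg P#S =
  +-cancelʳ-≡ (arcs G P Q) (arcs G P (S ─ Q)) (arcs G P (S ─ Q')) (begin
    arcs G P (S ─ Q) + arcs G P Q       ≡⟨ arcs-⊕ʳ G P (─-⊕ Q⊆S) ⟨
    arcs G P S                          ≡⟨ arcs-⊕ʳ G P (─-⊕ Q'⊆S) ⟩
    arcs G P (S ─ Q') + arcs G P Q'     ≡⟨ cong (arcs G P (S ─ Q') +_) into-Q ⟨
    arcs G P (S ─ Q') + arcs G P Q      ∎)
  where
  into-Q : arcs G P Q ≡ arcs G P Q'
  into-Q = begin
    arcs G P Q     ≡⟨ arcs-sym G P Q ⟩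
    arcs G Q P     ≡⟨ arcs-transferˡ G Q Q' P (same-deg ∘ P#S) ⟩
    arcs G Q' P    ≡⟨ arcs-sym G Q' P ⟩
    arcs G P Q'    ∎

<ᵇ-exactly-one : ∀ m k → m ≢ k → 𝟙 (m <ᵇ k) + 𝟙 (k <ᵇ m) ≡ 1
<ᵇ-exactly-one zero    zero    m≢k = contradiction refl m≢k
<ᵇ-exactly-one zero    (suc k) _   = refl
<ᵇ-exactly-one (suc m) zero    _   = refl
<ᵇ-exactly-one (suc m) (suc k) m≢k = <ᵇ-exactly-one m k (m≢k ∘ cong suc)

precedes : Fin n → Fin n → ℕ
precedes u v = 𝟙 (toℕ u <ᵇ toℕ v)

-- The order test in edgeCount accepts exactly one orientation of each
-- edge (loops do not occur).
one-orientation : (G : Graph n) (u v : Fin n) →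
  (precedes u v + precedes v u) * edge G u v ≡ edge G u v
one-orientation G u v with u ≟ v
... | yes refl rewrite irrefl G u = *-zeroʳ (precedes u u + precedes u u)
... | no  u≢v  = trans (cong (_* edge G u v) (<ᵇ-exactly-one _ _ (u≢v ∘ toℕ-injective)))
                       (+-identityʳ (edge G u v))

both-orientations : (G : Graph n) (P Q : Subset n) (u v : Fin n) →
  precedes u v * arc G P Q u v + precedes v u * arc G P Q u v ≡ arc G P Q u v
both-orientations G P Q u v = begin
  precedes u v * arc G P Q u v + precedes v u * arc G P Q u v
    ≡⟨ *-distribʳ-+ (arc G P Q u v) (precedes u v) (precedes v u) ⟨
  (precedes u v + precedes v u) * (𝟙[ P ] u * 𝟙[ Q ] v * edge G u v)
    ≡⟨ x∙yz≈y∙xz (precedes u v + precedes v u) (𝟙[ P ] u * 𝟙[ Q ] v) (edge G u v) ⟩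
  𝟙[ P ] u * 𝟙[ Q ] v * ((precedes u v + precedes v u) * edge G u v)
    ≡⟨ cong (𝟙[ P ] u * 𝟙[ Q ] v *_) (one-orientation G u v) ⟩
  arc G P Q u v
    ∎

Disjoint⇒exclusive : Disjoint P Q → ∀ u v →
  (lookup P u ∧ lookup Q v) ∧ (lookup P v ∧ lookup Q u) ≡ false
Disjoint⇒exclusive {P = P} {Q = Q} P#Q u v with lookup P u in u∈P
... | false = refl
... | true  rewrite ∉⇒lookup (P#Q (lookup⇒[]= u P u∈P)) =
  trans (cong (lookup Q v ∧_) (∧-zeroʳ (lookup P v))) (∧-zeroʳ (lookup Q v))

edgeCount-term : (G : Graph n) (P Q : Subset n) → Disjoint P Q → (u v : Fin n) →
  𝟙 ((toℕ u <ᵇ toℕ v) ∧ adj G u v ∧ ((lookup P u ∧ lookup Q v) ∨ (lookup P v ∧ lookup Q u)))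
    ≡ precedes u v * arc G P Q u v + precedes u v * arc G P Q v u
edgeCount-term G P Q P#Q u v = begin
  𝟙 ((toℕ u <ᵇ toℕ v) ∧ adj G u v ∧ (PuQv ∨ PvQu))
    ≡⟨ 𝟙-∧ (toℕ u <ᵇ toℕ v) _ ⟩
  precedes u v * 𝟙 (adj G u v ∧ (PuQv ∨ PvQu))
    ≡⟨ cong (precedes u v *_) (𝟙-∧ (adj G u v) _) ⟩
  precedes u v * (edge G u v * 𝟙 (PuQv ∨ PvQu))
    ≡⟨ cong (λ k → precedes u v * (edge G u v * k)) (𝟙-∨ PuQv PvQu (Disjoint⇒exclusive P#Q u v)) ⟩
  precedes u v * (edge G u v * (𝟙 PuQv + 𝟙 PvQu))
    ≡⟨ cong (λ k → precedes u v * (edge G u v * k))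
            (cong₂ _+_ (𝟙-∧ (lookup P u) _) (𝟙-∧ (lookup P v) _)) ⟩
  precedes u v * (edge G u v * (𝟙[ P ] u * 𝟙[ Q ] v + 𝟙[ P ] v * 𝟙[ Q ] u))
    ≡⟨ distribute (precedes u v) (edge G u v) (𝟙[ P ] u * 𝟙[ Q ] v) (𝟙[ P ] v * 𝟙[ Q ] u) ⟩
  precedes u v * arc G P Q u v + precedes u v * (𝟙[ P ] v * 𝟙[ Q ] u * edge G u v)
    ≡⟨ cong (λ e → precedes u v * arc G P Q u v + precedes u v * (𝟙[ P ] v * 𝟙[ Q ] u * e))
            (edge-sym G u v) ⟩
  precedes u v * arc G P Q u v + precedes u v * arc G P Q v u
    ∎
  where
  PuQv = lookup P u ∧ lookup Q v
  PvQu = lookup P v ∧ lookup Q u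
  distribute : ∀ l e a b → l * (e * (a + b)) ≡ l * (a * e) + l * (b * e)
  distribute = solve-∀

-- Between disjoint sets, edgeCount counts each edge once, as an arc from
-- its end in P to its end in Q.
edgeCount≡arcs : (G : Graph n) (P Q : Subset n) → Disjoint P Q →
                 edgeCount G P Q ≡ arcs G P Q
edgeCount≡arcs {n} G P Q P#Q = begin
  edgeCount G P Q
    ≡⟨ listSum-allFin (λ u → listSum (map (counted u) (allFin n))) ⟩
  ∑[ u < n ] listSum (map (counted u) (allFin n))
    ≡⟨ sum-cong-≗ (λ u → listSum-allFin (counted u)) ⟩
  ∑[ u < n ] ∑[ v < n ] counted u v
    ≡⟨ ∑∑-cong (edgeCount-term G P Q P#Q) ⟩
  ∑[ u < n ] ∑[ v < n ] (forward u v + backward u v)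
    ≡⟨ ∑∑-distrib-+ forward backward ⟩
  ∑[ u < n ] ∑[ v < n ] forward u v + ∑[ u < n ] ∑[ v < n ] backward u v
    ≡⟨ cong (∑[ u < n ] ∑[ v < n ] forward u v +_) (∑-comm backward) ⟩
  ∑[ u < n ] ∑[ v < n ] forward u v + ∑[ u < n ] ∑[ v < n ] backward v u
    ≡⟨ ∑∑-distrib-+ forward (λ u v → backward v u) ⟨
  ∑[ u < n ] ∑[ v < n ] (forward u v + backward v u)
    ≡⟨ ∑∑-cong (both-orientations G P Q) ⟩
  arcs G P Q
    ∎
  where
  counted forward backward : Fin n → Fin n → ℕ
  counted u v = 𝟙 ((toℕ u <ᵇ toℕ v) ∧ adj G u v ∧
                   ((lookup P u ∧ lookup Q v) ∨ (lookup P v ∧ lookup Q u)))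
  forward u v = precedes u v * arc G P Q u v
  backward u v = precedes u v * arc G P Q v u

V⊆leaves : (t : Tree n) → v ∈ V t → v ∈ₗ leaves t
V⊆leaves (leaf w)   v∈V = here (x∈⁅y⁆⇒x≡y w v∈V)
V⊆leaves (node l r) v∈V =
  [ ∈-++⁺ˡ ∘ V⊆leaves l , ∈-++⁺ʳ (leaves l) ∘ V⊆leaves r ]′ (x∈p∪q⁻ (V l) (V r) v∈V)

module _ {A : Set} where

  Unique-++ˡ : (xs : List A) {ys : List A} → Unique (xs ++ ys) → Unique xs
  Unique-++ˡ []       _              = []
  Unique-++ˡ (x ∷ xs) (x∉ ∷ unique) = ++⁻ˡ xs x∉ ∷ Unique-++ˡ xs unique

  Unique-++ʳ : (xs : List A) {ys : List A} → Unique (xs ++ ys) → Unique ys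
  Unique-++ʳ []       unique         = unique
  Unique-++ʳ (x ∷ xs) (_ ∷ unique)   = Unique-++ʳ xs unique

  Unique-++-disjoint : (xs : List A) {ys : List A} {y : A} →
                       Unique (xs ++ ys) → y ∈ₗ xs → y ∉ₗ ys
  Unique-++-disjoint (x ∷ xs) (x∉ ∷ _)      (here refl) y∈ys = allLookup (++⁻ʳ xs x∉) y∈ys refl
  Unique-++-disjoint (x ∷ xs) (_ ∷ unique)  (there y∈xs) y∈ys = Unique-++-disjoint xs unique y∈xs y∈ys

Unique-≼ : {t T : Tree n} → t ≼ T → Unique (leaves T) → Unique (leaves t)
Unique-≼ here                    unique = unique
Unique-≼ (left  {l = l} t≼l)     unique = Unique-≼ t≼l (Unique-++ˡ (leaves l) unique)
Unique-≼ (right {l = l} t≼r)     unique = Unique-≼ t≼r (Unique-++ʳ (leaves l) unique)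

layout-disjoint : {T a b : Tree n} → IsLayout T → node a b ≼ T → Disjoint (V a) (V b)
layout-disjoint {a = a} {b} (unique , _) ab≼T v∈Va v∈Vb =
  Unique-++-disjoint (leaves a) (Unique-≼ ab≼T unique) (V⊆leaves a v∈Va) (V⊆leaves b v∈Vb)

InRep⇒⊆ : (G : Graph n) {R : Subset n} → InRep G S R → R ⊆ S
InRep⇒⊆ G (_ , _ , R⊆S , _) = R⊆S

arcs-cross : (G : Graph n) (X A W B : Subset n) → Disjoint S S' →
  A ⊆ S → W ⊆ S' → B ⊆ S' → Equiv G S A X → Equiv G S' B W →
  arcs G X (S' ─ W) ≡ arcs G A (S' ─ B)
arcs-cross {S' = S'} G X A W B S#S' A⊆S W⊆S' B⊆S' A≡X B≡W = begin
  arcs G X (S' ─ W)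
    ≡⟨ arcs-transferˡ G X A (S' ─ W)
         (λ v∈S'─W → ≡-sym (Equiv⇒deg G A X A≡X (Disjoint-sym S#S' (p─q⊆p S' W v∈S'─W)))) ⟩
  arcs G A (S' ─ W)
    ≡⟨ arcs-complement G W⊆S' B⊆S' (≡-sym ∘ Equiv⇒deg G B W B≡W) (Disjoint-⊆ A⊆S ⊆-refl S#S') ⟩
  arcs G A (S' ─ B)
    ∎

lemma7p1 : ∀ {n : ℕ} (G : Graph n) (T : Tree n) → IsLayout T →
    (a b : Tree n) → node a b ≼ T →
    (A B : Subset n) → InRep G (V a) A → InRep G (V b) B →
    (X W : Subset n) → X ⊆ V a → W ⊆ V b →
    Equiv G (V a) A X → Equiv G (V b) B W →
    edgeCount G (X ∪ W) (V (node a b) ─ (X ∪ W))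
      ≡ edgeCount G X (V a ─ X) + edgeCount G W (V b ─ W)
        + edgeCount G A (V b ─ B) + edgeCount G B (V a ─ A)
lemma7p1 G T layout a b ab≼T A B A-rep B-rep X W X⊆Va W⊆Vb A≡X B≡W = begin
  edgeCount G (X ∪ W) (V (node a b) ─ (X ∪ W))
    ≡⟨ edgeCount≡arcs G (X ∪ W) _ (Disjoint-─ (X ∪ W) (V (node a b))) ⟩
  arcs G (X ∪ W) ((V a ∪ V b) ─ (X ∪ W))
    ≡⟨ arcs-bilinear G (∪-⊕ (Disjoint-⊆ X⊆Va W⊆Vb Va#Vb)) (∪─∪-⊕ Va#Vb X⊆Va W⊆Vb) ⟩
  arcs G X (V a ─ X) + arcs G X (V b ─ W) + arcs G W (V a ─ X) + arcs G W (V b ─ W)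
    ≡⟨ cong₂ (λ p q → arcs G X (V a ─ X) + p + q + arcs G W (V b ─ W))
         (arcs-cross G X A W B Va#Vb A⊆Va W⊆Vb B⊆Vb A≡X B≡W)
         (arcs-cross G W B X A (Disjoint-sym Va#Vb) B⊆Vb X⊆Va A⊆Va B≡W A≡X) ⟩
  arcs G X (V a ─ X) + arcs G A (V b ─ B) + arcs G B (V a ─ A) + arcs G W (V b ─ W)
    ≡⟨ move-last-to-second (arcs G X (V a ─ X)) _ _ _ ⟩
  arcs G X (V a ─ X) + arcs G W (V b ─ W) + arcs G A (V b ─ B) + arcs G B (V a ─ A)
    ≡⟨ cong₂ _+_ (cong₂ _+_ (cong₂ _+_ (inside a X) (inside b W))
                           (across Va#Vb A⊆Va B)) (across (Disjoint-sym Va#Vb) B⊆Vb A) ⟨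
  edgeCount G X (V a ─ X) + edgeCount G W (V b ─ W)
    + edgeCount G A (V b ─ B) + edgeCount G B (V a ─ A)
    ∎
  where
  Va#Vb = layout-disjoint layout ab≼T
  A⊆Va = InRep⇒⊆ G A-rep
  B⊆Vb = InRep⇒⊆ G B-rep
  inside : ∀ t Z → edgeCount G Z (V t ─ Z) ≡ arcs G Z (V t ─ Z)
  inside t Z = edgeCount≡arcs G Z (V t ─ Z) (Disjoint-─ Z (V t))
  across : ∀ {S S'} → Disjoint S S' → ∀ {R} → R ⊆ S → ∀ Z →
           edgeCount G R (S' ─ Z) ≡ arcs G R (S' ─ Z)
  across {S' = S'} S#S' R⊆S Z = edgeCount≡arcs G _ (S' ─ Z) (Disjoint-⊆ R⊆S (p─q⊆p S' Z) S#S')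
  move-last-to-second : ∀ p q r s → p + q + r + s ≡ p + s + q + r
  move-last-to-second = solve-∀
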